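{- FIFO is a $(1+\gamma/\gamma_0)$-approximation algorithm for C-WGP, where $\gamma=d_I+2$ and $\gamma_0=\lfloor (d_I+1)/2\rfloor$: on every instance, the maximum completion time $\max_j C_j$ of the FIFO schedule is at most $(1+\gamma/\gamma_0)$ times the minimum possible maximum completion time over all feasible schedules.
   Context: The Wireless Gathering Problem (WGP). An instance consists of a finite connected undirected graph $G=(V,E)$, a sink node $s\in V$, a positive integer $d_I$ (interference radius), and a set of packets $J=\{1,\dots,m\}$; each packet $j$ has an origin $o_j\in V$ and a release date $r_j\in\mathbb{Z}_{\ge 0}$. Time is divided into rounds $0,1,2,\dots$. In a round, if $u,v$ are adjacent, $u$ may send a packet it currently holds to $v$; this is a call $(u,v)$. Let $d(u,v)$ be the shortest-path distance in $G$. Two calls $(u,v)$ and $(u',v')$ in the same round interfere if $d(u',v)\le d_I$ or $d(u,v')\le d_I$; otherwise they are compatible. A feasible schedule specifies, for each round, a set of pairwise compatible calls, each moving one packet, such that every packet exists in a unique copy, packet $j$ is not sent before round $r_j$, and every packet eventually reaches $s$. If $x_j^t$ is the node holding $j$ at time $t$ (a packet sent in round $t$ is at its new node at time $t+1$), the completion time is $C_j=\min\{t: x_j^t=s\}$. C-WGP is the problem of finding a feasible schedule minimizing $\max_j C_j$. Priority Greedy: each packet is given a unique priority; in every round, the available packets (released and not yet at $s$) are considered in order of decreasing priority, and each is sent from its current node to a neighbor one step closer to $s$ (i.e. along a shortest path to $s$), provided this call causes no interference with the calls already chosen in this round for higher-priority packets; otherwise it is not sent in this round. FIFO is the Priority Greedy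 algorithm in which packets with earlier release dates have higher priority (ties broken arbitrarily). -}

module Defs where

open import Data.Nat using (ℕ; zero; suc; _+_; _*_; _≤_; _<_; _/_)
open import Data.Fin using (Fin)
open import Data.Bool using (Bool; true; false; T)
open import Data.Product using (Σ; ∃; ∃-syntax; _×_; _,_)
open import Data.Sum using (_⊎_)
open import Function.Definitions using (Injective)
open import Relation.Binary.PropositionalEquality using (_≡_; _≢_)
open import Relation.Nullary using (¬_)

record Graph : Set where
  field
    n          : ℕ
    adj        : Fin n → Fin n → Bool
    adj-sym    : ∀ u v → adj u v ≡ adj v u
    adj-irrefl : ∀ u → adj u u ≡ false

module _ (G : Graph) where
  open Graph G

  Adj : Fin n → Fin n → Set
  Adj u v = T (adj u v)

  data Walk : Fin n → Fin n → ℕ → Set where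
    here : ∀ {u} → Walk u u 0
    step : ∀ {u w v k} → Adj u w → Walk w v k → Walk u v (suc k)

  Dist : Fin n → Fin n → ℕ → Set
  Dist u v k = Walk u v k × (∀ k' → Walk u v k' → k ≤ k')

  Connected : Set
  Connected = ∀ u v → ∃[ k ] Walk u v k

record Instance : Set where
  field
    G         : Graph
    connected : Connected G
    sink      : Fin (Graph.n G)
    dI        : ℕ
    dI-pos    : 1 ≤ dI
    m         : ℕ
    origin    : Fin m → Fin (Graph.n G)
    release   : Fin m → ℕ

module _ (I : Instance) where
  open Instance I

  V : Set
  V = Fin (Graph.n G)

  WithinDI : V → V → Set
  WithinDI u v = ∃[ k ] Dist G u v k × k ≤ dI

  Interfere : V × V → V × V → Set
  Interfere (u , v) (u' , v') = WithinDI u' v ⊎ WithinDI u v'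

  Compatible : V × V → V × V → Set
  Compatible c c' = ¬ Interfere c c'

  -- A schedule is described by the positions x t j of every packet j at
  -- every time t (packet sent in round t is at its new node at time t+1).
  Positions : Set
  Positions = ℕ → Fin m → V

  Moves : Positions → ℕ → Fin m → Set
  Moves x t j = x (suc t) j ≢ x t j

  call : Positions → ℕ → Fin m → V × V
  call x t j = (x t j , x (suc t) j)

  record Feasible (x : Positions) : Set where
    field
      start    : ∀ j → x 0 j ≡ origin j
      adjacent : ∀ t j → Moves x t j → Adj G (x t j) (x (suc t) j)
      released : ∀ t j → Moves x t j → release j ≤ t
      compat   : ∀ t j j' → j ≢ j' → Moves x t j → Moves x t j' →
                 Compatible (call x t j) (call x t j')
      reaches  : ∀ j → ∃[ t ] x t j ≡ sink

  CompletesBy : Positions → ℕ → Set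
  CompletesBy x T = ∀ j → ∃[ t ] t ≤ T × x t j ≡ sink

  Closer : V → V → Set
  Closer u v = Adj G u v × ∃[ k ] Dist G v sink k × Dist G u sink (suc k)

  Available : Positions → ℕ → Fin m → Set
  Available x t j = release j ≤ t × x t j ≢ sink

  -- x is a possible execution of Priority Greedy with priorities prio
  -- (larger value = higher priority); the choice among neighbours one
  -- step closer to the sink is arbitrary.
  record PriorityGreedyRun (prio : Fin m → ℕ) (x : Positions) : Set where
    field
      start   : ∀ j → x 0 j ≡ origin j
      idle    : ∀ t j → ¬ Available x t j → x (suc t) j ≡ x t j
      sent    : ∀ t j → Available x t j → Moves x t j →
                Closer (x t j) (x (suc t) j) ×
                (∀ j' → prio j < prio j' → Moves x t j' →
                   Compatible (call x t j) (call x t j'))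
      blocked : ∀ t j → Available x t j → x (suc t) j ≡ x t j →
                ∃[ v ] Closer (x t j) v ×
                  ∃[ j' ] prio j < prio j' × Moves x t j' ×
                    Interfere (x t j , v) (call x t j')

  FIFORun : Positions → Set
  FIFORun x = ∃[ prio ] Injective _≡_ _≡_ prio ×
              (∀ j j' → release j < release j' → prio j' < prio j) ×
              PriorityGreedyRun prio x

  γ : ℕ
  γ = dI + 2

  γ₀ : ℕ
  γ₀ = (dI + 1) / 2

module Submission where

open import Defs
open import Data.Nat using (ℕ; _+_; _*_; _≤_)
open import Data.Fin using (Fin)
open import Data.Product using (∃-syntax; _×_)
open import Relation.Binary.PropositionalEquality using (_≡_)

open import Data.Nat using (zero; suc; _<_; _⊓_; _⊔_; _∸_; _/_; _≤?_; _<?_; z≤n; s≤s; _≤′_; ≤′-refl; ≤′-step)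
open import Data.Nat.Properties
open import Data.Nat.DivMod using (m/n≤m; m/n*n≤m)
open import Data.Nat.Induction using (<-rec; <-wellFounded)
open import Data.Nat.ListAction using (sum)
import Data.Fin as Fin
import Data.Fin.Properties as FinP
open import Data.Product using (_,_; proj₁; proj₂)
open import Data.Sum using (_⊎_; inj₁; inj₂)
open import Data.Empty using (⊥-elim)
open import Data.List using (List; []; _∷_; map)
open import Data.List.Properties using (map-cong)
open import Data.List.Relation.Unary.All as All using (All; []; _∷_)
open import Data.List.Relation.Unary.AllPairs using ([]; _∷_)
open import Data.List.Relation.Unary.Unique.Propositional using (Unique)
open import Function using (_∘_)
open import Data.Nat.Tactic.RingSolver using (solve-∀)
import Induction.WellFounded as WF
import Relation.Binary.Construct.On as On
open import Relation.Nullary using (¬_; Dec; yes; no)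
open import Data.Bool using (T)
open import Relation.Nullary.Decidable using (T?; ¬?; _×-dec_)
open import Relation.Binary.PropositionalEquality using (refl; sym; trans; cong; cong₂; subst; _≢_)

-- Write ℓ(v) for the distance from v to
-- the sink and Lₖ = ℓ(oₖ).  The argument compares a Priority Greedy run x
-- with an arbitrary feasible schedule y completing by time T.
--
-- By well-founded induction on decreasing priority,
-- every packet j reaches the sink at some time C with
--       C ≤ T + Σ_{k∈S} (γ ⊓ Lₖ)
-- for a list S of distinct packets.  If j is never blocked it travels
-- freely and arrives by rⱼ + Lⱼ ≤ T; otherwise, when j is blocked for the
-- last time, its blocker k is at most dI+1 levels closer to the sink and
-- already has such a bound, so j arrives within γ ⊓ Lⱼ rounds after k.
--
-- Once a packet moves to within γ₀ - 1 of the
-- sink, no other packet can move there in the same round (the calls would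
-- interfere), so a potential counting every packet's best depth inside
-- that ball drops by at most one per round: Σ_{k∈S} (Lₖ ⊓ γ₀) ≤ T.
--
-- Since γ₀ (γ ⊓ L) ≤ γ (L ⊓ γ₀), the two bounds give γ₀ C ≤ (γ₀ + γ) T.

-- The least witness of a decidable property of naturals that has one;
-- it turns a walk into a shortest path.
leastWitness : {P : ℕ → Set} → (∀ n → Dec (P n)) → ∀ K → P K →
               ∃[ n ] P n × (∀ k → P k → n ≤ k)
leastWitness {P} P? = <-rec Least search
  where
  Least : ℕ → Set
  Least K = P K → ∃[ n ] P n × (∀ k → P k → n ≤ k)

  search : ∀ K → (∀ {n} → n < K → Least n) → Least K
  search K smaller pK with anyUpTo? P? K
  ... | yes (n , n<K , pn) = smaller n<K pn
  ... | no none            = K , pK , λ k pk → ≮⇒≥ (λ k<K → none (k , k<K , pk))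

lastWitness : {P : ℕ → Set} → (∀ n → Dec (P n)) → ∀ b → (∀ t → b ≤ t → ¬ P t) →
              (∃[ t ] P t × (∀ t' → t < t' → ¬ P t')) ⊎ (∀ t → ¬ P t)
lastWitness P? zero    never = inj₂ (λ t → never t z≤n)
lastWitness P? (suc b) never with P? b
... | yes pb = inj₁ (b , pb , never)
... | no ¬pb = lastWitness P? b neverFrom-b
  where
  neverFrom-b : ∀ t → b ≤ t → ¬ _
  neverFrom-b t b≤t with t ≟ b
  ... | yes refl = ¬pb
  ... | no t≢b   = never t (≤∧≢⇒< b≤t (t≢b ∘ sym))

finiteBound : ∀ {n} (f : Fin n → ℕ) → ∃[ B ] (∀ i → f i ≤ B)
finiteBound {zero}  f = 0 , λ ()
finiteBound {suc n} f with finiteBound (f ∘ Fin.suc)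
... | B , bounded = f Fin.zero ⊔ B , λ
  { Fin.zero    → m≤m⊔n _ _
  ; (Fin.suc i) → ≤-trans (bounded i) (m≤n⊔m _ _) }

-- On a finite index set, "k has a larger value than j" is well-founded;
-- this is induction on decreasing priority.
larger-wellFounded : ∀ {n} (f : Fin n → ℕ) → WF.WellFounded (λ k j → f j < f k)
larger-wellFounded f =
  WF.Subrelation.wellFounded gap-shrinks (On.wellFounded gap <-wellFounded)
  where
  B = proj₁ (finiteBound f)

  gap : Fin _ → ℕ
  gap j = B ∸ f j

  gap-shrinks : ∀ {k j} → f j < f k → gap k < gap j
  gap-shrinks {k} fj<fk = ∸-monoʳ-< fj<fk (proj₂ (finiteBound f) k)

half+half≤ : ∀ n → n / 2 + n / 2 ≤ n
half+half≤ n = begin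
  n / 2 + n / 2       ≡⟨ cong (n / 2 +_) (sym (+-identityʳ (n / 2))) ⟩
  2 * (n / 2)         ≡⟨ *-comm 2 (n / 2) ⟩
  n / 2 * 2           ≤⟨ m/n*n≤m n 2 ⟩
  n                   ∎
  where open ≤-Reasoning

⊓-below : ∀ {a b} → a ⊓ b < a → b < a
⊓-below {a} {b} lt = ≰⇒> (λ a≤b → <-irrefl (m≤n⇒m⊓n≡m a≤b) lt)

-- Exchanging the caps of a weighted minimum: a (b ⊓ L) ≤ b (L ⊓ a) when
-- a ≤ b.  Applied termwise it converts the greedy delays into the
-- optimum's lower bound.
min-exchange : ∀ {a b} → a ≤ b → ∀ L → a * (b ⊓ L) ≤ b * (L ⊓ a)
min-exchange {a} {b} a≤b L with ≤-total L a
... | inj₁ L≤a = begin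
  a * (b ⊓ L)   ≤⟨ *-monoʳ-≤ a (m⊓n≤n b L) ⟩
  a * L         ≤⟨ *-monoˡ-≤ L a≤b ⟩
  b * L         ≡⟨ cong (b *_) (sym (m≤n⇒m⊓n≡m L≤a)) ⟩
  b * (L ⊓ a)   ∎
  where open ≤-Reasoning
... | inj₂ a≤L = begin
  a * (b ⊓ L)   ≤⟨ *-monoʳ-≤ a (m⊓n≤m b L) ⟩
  a * b         ≡⟨ *-comm a b ⟩
  b * a         ≡⟨ cong (b *_) (sym (m≥n⇒m⊓n≡n a≤L)) ⟩
  b * (L ⊓ a)   ∎
  where open ≤-Reasoning

sum-exchange : ∀ {A : Set} {a b} → a ≤ b → (L : A → ℕ) → ∀ S →
               a * sum (map (λ k → b ⊓ L k) S) ≤ b * sum (map (λ k → L k ⊓ a) S)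
sum-exchange {a = a} {b} a≤b L []      = ≤-reflexive (trans (*-zeroʳ a) (sym (*-zeroʳ b)))
sum-exchange {a = a} {b} a≤b L (k ∷ S) = begin
  a * (b ⊓ L k + sum (map (λ k → b ⊓ L k) S))
    ≡⟨ *-distribˡ-+ a _ _ ⟩
  a * (b ⊓ L k) + a * sum (map (λ k → b ⊓ L k) S)
    ≤⟨ +-mono-≤ (min-exchange a≤b (L k)) (sum-exchange a≤b L S) ⟩
  b * (L k ⊓ a) + b * sum (map (λ k → L k ⊓ a) S)
    ≡⟨ sym (*-distribˡ-+ b _ _) ⟩
  b * (L k ⊓ a + sum (map (λ k → L k ⊓ a) S))
    ∎
  where open ≤-Reasoning

sum-map-zero : ∀ {A : Set} {f : A → ℕ} → (∀ a → f a ≡ 0) → ∀ S → sum (map f S) ≡ 0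
sum-map-zero zero-everywhere []      = refl
sum-map-zero zero-everywhere (a ∷ S) =
  cong₂ _+_ (zero-everywhere a) (sum-map-zero zero-everywhere S)

module PotentialDrop {A : Set} (f : A → ℕ → ℕ)
  (drops-by-one : ∀ a t → f a t ≤ suc (f a (suc t)))
  (exclusive : ∀ {a b} t → a ≢ b → f a (suc t) < f a t → ¬ f b (suc t) < f b t)
  where

  Φ : ℕ → List A → ℕ
  Φ t S = sum (map (λ a → f a t) S)

  Φ-steady : ∀ {t} S → All (λ a → ¬ f a (suc t) < f a t) S → Φ t S ≤ Φ (suc t) S
  Φ-steady []      []           = z≤n
  Φ-steady (a ∷ S) (steady ∷ rest) = +-mono-≤ (≮⇒≥ steady) (Φ-steady S rest)

  Φ-step : ∀ t S → Unique S → Φ t S ≤ suc (Φ (suc t) S)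
  Φ-step t []      _                = z≤n
  Φ-step t (a ∷ S) (a∉S ∷ distinct) with f a (suc t) <? f a t
  ... | yes drop   = +-mono-≤ (drops-by-one a t)
                       (Φ-steady S (All.map (λ a≢b → exclusive t a≢b drop) a∉S))
  ... | no steady  = ≤-trans (+-mono-≤ (≮⇒≥ steady) (Φ-step t S distinct))
                             (≤-reflexive (+-suc _ _))

  Φ-bound : ∀ S → Unique S → ∀ t → Φ 0 S ≤ t + Φ t S
  Φ-bound S distinct zero    = ≤-refl
  Φ-bound S distinct (suc t) = ≤-trans (Φ-bound S distinct t)
    (≤-trans (+-monoʳ-≤ t (Φ-step t S distinct)) (≤-reflexive (+-suc t _)))

module Walks (G : Graph) where
  open Graph G

  _++ʷ_ : ∀ {u w v a b} → Walk G u w a → Walk G w v b → Walk G u v (a + b)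
  here     ++ʷ q = q
  step e p ++ʷ q = step e (p ++ʷ q)

  snocʷ : ∀ {u w v k} → Walk G u w k → Adj G w v → Walk G u v (suc k)
  snocʷ here       e' = step e' here
  snocʷ (step e p) e' = step e (snocʷ p e')

  reverseʷ : ∀ {u v k} → Walk G u v k → Walk G v u k
  reverseʷ here               = here
  reverseʷ (step {u} {w} e p) = snocʷ (reverseʷ p) (subst T (adj-sym u w) e)

  trivialʷ : ∀ {u v} → Walk G u v 0 → u ≡ v
  trivialʷ here = refl

  walk? : ∀ k u v → Dec (Walk G u v k)
  walk? zero    u v with u FinP.≟ v
  ... | yes refl = yes here
  ... | no u≢v   = no (u≢v ∘ trivialʷ)
  walk? (suc k) u v with FinP.any? (λ w → T? (adj u w) ×-dec walk? k w v)
  ... | yes (w , e , p) = yes (step e p)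
  ... | no none         = no λ { (step {w = w} e p) → none (w , e , p) }

  shortest : ∀ {u v K} → Walk G u v K → ∃[ d ] Dist G u v d
  shortest {u} {v} = leastWitness (λ k → walk? k u v) _

module Levels (I : Instance) where
  open Instance I
  open Walks G

  distance : (u v : V I) → ∃[ d ] Dist G u v d
  distance u v = shortest (proj₂ (connected u v))

  dist : V I → V I → ℕ
  dist u v = proj₁ (distance u v)

  dist-walk : ∀ u v → Walk G u v (dist u v)
  dist-walk u v = proj₁ (proj₂ (distance u v))

  dist-least : ∀ {u v k} → Walk G u v k → dist u v ≤ k
  dist-least {u} {v} w = proj₂ (proj₂ (distance u v)) _ w

  dist-unique : ∀ {u v k} → Dist G u v k → dist u v ≡ k
  dist-unique {u} {v} (w , least) = ≤-antisym (dist-least w) (least _ (dist-walk u v))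

  level : V I → ℕ
  level v = dist v sink

  level-sink : level sink ≡ 0
  level-sink = n≤0⇒n≡0 (dist-least {sink} {sink} here)

  level≡0 : ∀ {v} → level v ≡ 0 → v ≡ sink
  level≡0 {v} eq = trivialʷ (subst (Walk G v sink) eq (dist-walk v sink))

  level-via : ∀ {u v k} → Walk G u v k → level u ≤ k + level v
  level-via {u} {v} w = dist-least (w ++ʷ dist-walk v sink)

  level-closer : ∀ {u v} → Closer I u v → level u ≡ suc (level v)
  level-closer (_ , k , dv , du) = trans (dist-unique du) (cong suc (sym (dist-unique dv)))

  interfering-levels : ∀ {u v u' v'} → level u ≡ suc (level v) → level v' ≤ level u' →
                       Interfere I (u , v) (u' , v') → level u ≤ level u' + suc dI
  interfering-levels {u} {v} {u'} {v'} lu _ (inj₁ (d , (w , _) , d≤dI)) = begin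
    level u                ≡⟨ lu ⟩
    suc (level v)          ≤⟨ s≤s (level-via (reverseʷ w)) ⟩
    suc (d + level u')     ≤⟨ s≤s (+-monoˡ-≤ _ d≤dI) ⟩
    suc (dI + level u')    ≡⟨ cong suc (+-comm dI _) ⟩
    suc (level u' + dI)    ≡⟨ sym (+-suc _ dI) ⟩
    level u' + suc dI      ∎
    where open ≤-Reasoning
  interfering-levels {u} {v} {u'} {v'} _ lv' (inj₂ (d , (w , _) , d≤dI)) = begin
    level u                ≤⟨ level-via w ⟩
    d + level v'           ≤⟨ +-mono-≤ d≤dI lv' ⟩
    dI + level u'          ≡⟨ +-comm dI _ ⟩
    level u' + dI          ≤⟨ +-monoʳ-≤ _ (n≤1+n dI) ⟩
    level u' + suc dI      ∎
    where open ≤-Reasoning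

  γ₀≤γ : γ₀ I ≤ γ I
  γ₀≤γ = ≤-trans (m/n≤m (dI + 1) 2) (+-monoʳ-≤ dI (n≤1+n 1))

  -- Two calls whose targets lie in the core ball {ℓ < γ₀} interfere:
  -- the sender of one is within 1 + 2(γ₀ - 1) ≤ dI of the other target.
  core-interference : ∀ {u' v' v} → Adj G u' v' → level v' < γ₀ I → level v < γ₀ I →
                      WithinDI I u' v
  core-interference {u'} {v'} {v} e lv' lv =
    dist u' v , distance-is , ≤-trans (dist-least w) (≤-pred short)
    where
    distance-is : Dist G u' v (dist u' v)
    distance-is = proj₂ (distance u' v)

    w : Walk G u' v (suc (level v' + level v))
    w = step e (dist-walk v' sink ++ʷ reverseʷ (dist-walk v sink))

    short : suc (suc (level v' + level v)) ≤ suc dI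
    short = begin
      suc (suc (level v' + level v)) ≡⟨ cong suc (sym (+-suc (level v') (level v))) ⟩
      suc (level v') + suc (level v) ≤⟨ +-mono-≤ lv' lv ⟩
      γ₀ I + γ₀ I                    ≤⟨ half+half≤ (dI + 1) ⟩
      dI + 1                         ≡⟨ +-comm dI 1 ⟩
      suc dI                         ∎
      where open ≤-Reasoning

  AlongEdges : Positions I → Set
  AlongEdges z = ∀ t k → z (suc t) k ≡ z t k ⊎ Adj G (z t k) (z (suc t) k)

  alongEdges : ∀ {z} → (∀ t k → Moves I z t k → Adj G (z t k) (z (suc t) k)) → AlongEdges z
  alongEdges {z} adjacent t k with z (suc t) k FinP.≟ z t k
  ... | yes stay = inj₁ stay
  ... | no moved = inj₂ (adjacent t k moved)

  level-step : ∀ {z} → AlongEdges z → ∀ t k → level (z t k) ≤ suc (level (z (suc t) k))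
  level-step along t k with along t k
  ... | inj₁ stay = ≤-trans (≤-reflexive (cong level (sym stay))) (n≤1+n _)
  ... | inj₂ e    = level-via (step e here)

  level-lipschitz : ∀ {z} → AlongEdges z → ∀ d t k → level (z t k) ≤ d + level (z (d + t) k)
  level-lipschitz along zero    t k = ≤-refl
  level-lipschitz along (suc d) t k = ≤-trans (level-lipschitz along d t k)
    (≤-trans (+-monoʳ-≤ d (level-step along (d + t) k)) (≤-reflexive (+-suc d _)))

  arrival-bound : ∀ {z} → AlongEdges z → ∀ {k t t'} → t ≤ t' → z t' k ≡ sink →
                  t + level (z t k) ≤ t'
  arrival-bound {z} along {k} {t} {t'} t≤t' arrived = begin
    t + level (z t k)                                   ≤⟨ +-monoʳ-≤ t (level-lipschitz along (t' ∸ t) t k) ⟩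
    t + ((t' ∸ t) + level (z ((t' ∸ t) + t) k))          ≡⟨ cong (λ s → t + ((t' ∸ t) + level (z s k))) (m∸n+n≡m t≤t') ⟩
    t + ((t' ∸ t) + level (z t' k))                     ≡⟨ cong (λ v → t + ((t' ∸ t) + level v)) arrived ⟩
    t + ((t' ∸ t) + level sink)                         ≡⟨ cong (λ l → t + ((t' ∸ t) + l)) level-sink ⟩
    t + ((t' ∸ t) + 0)                                  ≡⟨ cong (t +_) (+-identityʳ _) ⟩
    t + (t' ∸ t)                                        ≡⟨ m+[n∸m]≡n t≤t' ⟩
    t'                                                  ∎
    where open ≤-Reasoning

  unmoved-before-release : ∀ {z} → (∀ t j → Moves I z t j → release j ≤ t) →
                           ∀ {j} t → t ≤ release j → z t j ≡ z 0 j
  unmoved-before-release released zero _ = refl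
  unmoved-before-release {z} released {j} (suc t) le with z (suc t) j FinP.≟ z t j
  ... | yes stay = trans stay (unmoved-before-release released t (≤-trans (n≤1+n t) le))
  ... | no moved = ⊥-elim (<⇒≱ le (released t j moved))

  -- T bounds the arrival time of every packet that travelled alone.
  SoloBound : ℕ → Set
  SoloBound T = ∀ j → origin j ≢ sink → release j + level (origin j) ≤ T

module LowerBounds (I : Instance) (y : Positions I) (feasible : Feasible I y)
                   (T : ℕ) (done : CompletesBy I y T) where
  open Instance I
  open Levels I
  open Feasible feasible renaming (start to starts-at-origin)

  y-alongEdges : AlongEdges y
  y-alongEdges = alongEdges adjacent

  origin-until-release : ∀ {k t} → t ≤ release k → origin k ≡ y t k
  origin-until-release t≤r = trans (sym (starts-at-origin _)) (sym (unmoved-before-release released _ t≤r))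

  solo-bound : SoloBound T
  solo-bound k away with done k
  ... | t* , t*≤T , arrived with release k ≤? t*
  ...   | yes r≤t* = ≤-trans (≤-reflexive (cong (λ v → release k + level v) (origin-until-release ≤-refl)))
                       (≤-trans (arrival-bound y-alongEdges r≤t* arrived) t*≤T)
  ...   | no  r≰t* = ⊥-elim (away (trans (origin-until-release (<⇒≤ (≰⇒> r≰t*))) arrived))

  core : V I → ℕ
  core v = level v ⊓ γ₀ I

  bestCore : Fin m → ℕ → ℕ
  bestCore k zero    = core (y 0 k)
  bestCore k (suc t) = bestCore k t ⊓ core (y (suc t) k)

  bestCore≤core : ∀ k t → bestCore k t ≤ core (y t k)
  bestCore≤core k zero    = ≤-refl
  bestCore≤core k (suc t) = m⊓n≤n _ _

  bestCore-antitone : ∀ k {t t'} → t ≤′ t' → bestCore k t' ≤ bestCore k t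
  bestCore-antitone k ≤′-refl       = ≤-refl
  bestCore-antitone k (≤′-step t≤t') = ≤-trans (m⊓n≤m _ _) (bestCore-antitone k t≤t')

  bestCore-done : ∀ k → bestCore k T ≡ 0
  bestCore-done k with done k
  ... | t* , t*≤T , arrived = n≤0⇒n≡0 (begin
    bestCore k T       ≤⟨ bestCore-antitone k (≤⇒≤′ t*≤T) ⟩
    bestCore k t*      ≤⟨ bestCore≤core k t* ⟩
    core (y t* k)      ≡⟨ cong core arrived ⟩
    level sink ⊓ γ₀ I  ≡⟨ cong (_⊓ γ₀ I) level-sink ⟩
    0                  ∎)
    where open ≤-Reasoning

  bestCore-step : ∀ k t → bestCore k t ≤ suc (bestCore k (suc t))
  bestCore-step k t = ⊓-glb (n≤1+n _) (≤-trans (bestCore≤core k t) core-step)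
    where
    core-step : core (y t k) ≤ suc (core (y (suc t) k))
    core-step = ⊓-glb (≤-trans (m⊓n≤m _ _) (level-step y-alongEdges t k))
                      (≤-trans (m⊓n≤n _ _) (n≤1+n _))

  bestCore-drop : ∀ {k t} → bestCore k (suc t) < bestCore k t →
                  Moves I y t k × level (y (suc t) k) < γ₀ I
  bestCore-drop {k} {t} drop = moved , in-core
    where
    below : core (y (suc t) k) < bestCore k t
    below = ⊓-below drop

    moved : Moves I y t k
    moved stay = <⇒≱ below (≤-trans (bestCore≤core k t) (≤-reflexive (cong core (sym stay))))

    in-core : level (y (suc t) k) < γ₀ I
    in-core = ⊓-below (subst (_< γ₀ I) (⊓-comm (level (y (suc t) k)) (γ₀ I))
                (<-≤-trans below (≤-trans (bestCore≤core k t) (m⊓n≤n _ _))))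

  -- Two distinct packets cannot both improve their best core depth in the
  -- same round: their calls would interfere.
  bestCore-exclusive : ∀ {k k'} t → k ≢ k' → bestCore k (suc t) < bestCore k t →
                       ¬ bestCore k' (suc t) < bestCore k' t
  bestCore-exclusive {k} {k'} t k≢k' drop drop' with bestCore-drop drop | bestCore-drop drop'
  ... | moved , in-core | moved' , in-core' =
    compat t k k' k≢k' moved moved' (inj₁ (core-interference (adjacent t k' moved') in-core' in-core))

  core-sum≤T : ∀ S → Unique S → sum (map (λ k → level (origin k) ⊓ γ₀ I) S) ≤ T
  core-sum≤T S distinct = begin
    sum (map (λ k → core (origin k)) S)  ≡⟨ cong sum (map-cong (λ k → cong core (sym (starts-at-origin k))) S) ⟩
    Φ 0 S                                ≤⟨ Φ-bound S distinct T ⟩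
    T + Φ T S                            ≡⟨ cong (T +_) (sum-map-zero bestCore-done S) ⟩
    T + 0                                ≡⟨ +-identityʳ T ⟩
    T                                    ∎
    where
    open PotentialDrop bestCore bestCore-step bestCore-exclusive
    open ≤-Reasoning

module GreedyBound (I : Instance) (prio : Fin (Instance.m I) → ℕ) (x : Positions I)
                   (run : PriorityGreedyRun I prio x) (T : ℕ) (solo : Levels.SoloBound I T) where
  open Instance I
  open Levels I
  open PriorityGreedyRun run

  available? : ∀ t j → Dec (Available I x t j)
  available? t j = (release j ≤? t) ×-dec ¬? (x t j FinP.≟ sink)

  moves⇒available : ∀ {t j} → Moves I x t j → Available I x t j
  moves⇒available {t} {j} moved with available? t j
  ... | yes av  = av
  ... | no ¬av  = ⊥-elim (moved (idle t j ¬av))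

  level-move : ∀ {t j} → Moves I x t j → level (x t j) ≡ suc (level (x (suc t) j))
  level-move {t} {j} moved = level-closer (proj₁ (sent t j (moves⇒available moved) moved))

  x-alongEdges : AlongEdges x
  x-alongEdges = alongEdges (λ t j moved → proj₁ (proj₁ (sent t j (moves⇒available moved) moved)))

  level-nonincreasing : ∀ t j → level (x (suc t) j) ≤ level (x t j)
  level-nonincreasing t j with x (suc t) j FinP.≟ x t j
  ... | yes stay = ≤-reflexive (cong level stay)
  ... | no moved = ≤-trans (n≤1+n _) (≤-reflexive (sym (level-move moved)))

  level≤origin : ∀ t j → level (x t j) ≤ level (origin j)
  level≤origin zero    j = ≤-reflexive (cong level (start j))
  level≤origin (suc t) j = ≤-trans (level-nonincreasing t j) (level≤origin t j)

  at-release : ∀ j → x (release j) j ≡ origin j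
  at-release j = trans (unmoved-before-release (λ t j moved → proj₁ (moves⇒available moved))
                                                (release j) ≤-refl)
                       (start j)

  sink-absorbing : ∀ {j t t'} → x t j ≡ sink → t ≤ t' → x t' j ≡ sink
  sink-absorbing {j} {t} arrived t≤t' = stays (≤⇒≤′ t≤t')
    where
    stays : ∀ {t'} → t ≤′ t' → x t' j ≡ sink
    stays ≤′-refl            = arrived
    stays (≤′-step t≤t'')    = trans (idle _ j (λ av → proj₂ av (stays t≤t''))) (stays t≤t'')

  moves-before-arrival : ∀ {j t C} → x C j ≡ sink → Moves I x t j → t < C
  moves-before-arrival {t = t} arrived moved = ≰⇒> λ C≤t →
    moved (trans (sink-absorbing arrived (≤-trans C≤t (n≤1+n t))) (sym (sink-absorbing arrived C≤t)))

  Blocked : ℕ → Fin m → Set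
  Blocked t j = Available I x t j × x (suc t) j ≡ x t j

  blocked? : ∀ t j → Dec (Blocked t j)
  blocked? t j = available? t j ×-dec (x (suc t) j FinP.≟ x t j)

  blocker : ∀ {t j} → Blocked t j →
            ∃[ k ] prio j < prio k × Moves I x t k × level (x t j) ≤ level (x t k) + suc dI
  blocker {t} {j} (av , stay) with blocked t j av stay
  ... | v , closer , k , higher , moved , clash =
    k , higher , moved , interfering-levels (level-closer closer) (level-nonincreasing t k) clash

  free-run : ∀ {j} d t₀ → level (x t₀ j) ≡ d → release j ≤ t₀ →
             (∀ t → t₀ ≤ t → ¬ Blocked t j) → x (d + t₀) j ≡ sink
  free-run zero t₀ at-level _ _ = level≡0 at-level
  free-run {j} (suc d) t₀ at-level released free =
    subst (λ s → x s j ≡ sink) (+-suc d t₀)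
      (free-run d (suc t₀) (suc-injective (trans (sym (level-move moved)) at-level))
        (≤-trans released (n≤1+n t₀)) (λ t le → free t (≤-trans (n≤1+n t₀) le)))
    where
    away : x t₀ j ≢ sink
    away at-sink = 0≢1+n (trans (sym (trans (cong level at-sink) level-sink)) at-level)

    moved : Moves I x t₀ j
    moved stay = free t₀ ≤-refl ((released , away) , stay)

  -- The delay a packet k can inflict on the packets it blocks.
  weight : Fin m → ℕ
  weight k = γ I ⊓ level (origin k)

  record Bound (j : Fin m) : Set where
    field
      arrival   : ℕ
      arrives   : x arrival j ≡ sink
      delayers  : List (Fin m)
      distinct  : Unique delayers
      dominate  : All (λ k → prio j ≤ prio k) delayers
      on-time   : arrival ≤ T + sum (map weight delayers)

  -- Once all packets of higher priority have arrived, j is never blocked.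
  eventually-unblocked : ∀ {j} → (∀ {k} → prio j < prio k → Bound k) →
                         ∃[ b ] (∀ t → b ≤ t → ¬ Blocked t j)
  eventually-unblocked {j} higher-bound = B , unblocked
    where
    arrivalOf : Fin m → ℕ
    arrivalOf k with prio j <? prio k
    ... | yes higher = Bound.arrival (higher-bound higher)
    ... | no _       = 0

    arrives-by : ∀ {k} → prio j < prio k → x (arrivalOf k) k ≡ sink
    arrives-by {k} higher with prio j <? prio k
    ... | yes higher' = Bound.arrives (higher-bound higher')
    ... | no lower    = ⊥-elim (lower higher)

    B : ℕ
    B = proj₁ (finiteBound arrivalOf)

    unblocked : ∀ t → B ≤ t → ¬ Blocked t j
    unblocked t B≤t bl with blocker bl
    ... | k , higher , moved , _ =
      <⇒≱ (moves-before-arrival (arrives-by higher) moved)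
          (≤-trans (proj₂ (finiteBound arrivalOf) k) B≤t)

  never-blocked-bound : ∀ {j} → (∀ t → ¬ Blocked t j) → Bound j
  never-blocked-bound {j} never with origin j FinP.≟ sink
  ... | yes at-sink = record
    { arrival = 0 ; arrives = trans (start j) at-sink
    ; delayers = [] ; distinct = [] ; dominate = [] ; on-time = z≤n }
  ... | no away = record
    { arrival  = level (origin j) + release j
    ; arrives  = free-run (level (origin j)) (release j) (cong level (at-release j)) ≤-refl
                   (λ t _ → never t)
    ; delayers = [] ; distinct = [] ; dominate = []
    ; on-time  = ≤-trans (≤-reflexive (+-comm (level (origin j)) (release j)))
                   (≤-trans (solo j away) (m≤m+n T 0)) }

  -- After its last blocking round t, j arrives within weight j rounds of
  -- its blocker k: by then it has to cover at most the dI + 1 levels that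
  -- separated it from k, and never more than its initial level.
  after-blocker : ∀ {j k t C} → Blocked t j → Moves I x t k →
                  level (x t j) ≤ level (x t k) + suc dI → x C k ≡ sink →
                  level (x t j) + suc t ≤ C + weight j
  after-blocker {j} {k} {t} {C} bl moved near arrived =
    ≤-trans (⊓-glb via-blocker via-origin) (≤-reflexive (sym (+-distribˡ-⊓ C (γ I) (level (origin j)))))
    where
    t<C : t < C
    t<C = moves-before-arrival arrived moved

    shuffle : ∀ a b c → (a + suc b) + suc c ≡ (c + a) + (b + 2)
    shuffle = solve-∀

    via-blocker : level (x t j) + suc t ≤ C + γ I
    via-blocker = begin
      level (x t j) + suc t                  ≤⟨ +-monoˡ-≤ (suc t) near ⟩
      (level (x t k) + suc dI) + suc t       ≡⟨ shuffle (level (x t k)) dI t ⟩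
      (t + level (x t k)) + (dI + 2)         ≤⟨ +-monoˡ-≤ (dI + 2) (arrival-bound x-alongEdges (<⇒≤ t<C) arrived) ⟩
      C + γ I                                ∎
      where open ≤-Reasoning

    via-origin : level (x t j) + suc t ≤ C + level (origin j)
    via-origin = ≤-trans (+-mono-≤ (level≤origin t j) t<C) (≤-reflexive (+-comm (level (origin j)) C))

  last-blocked-bound : ∀ {j t} → Blocked t j → (∀ t' → t < t' → ¬ Blocked t' j) →
                       (∀ {k} → prio j < prio k → Bound k) → Bound j
  last-blocked-bound {j} {t} bl after higher-bound with blocker bl
  ... | k , higher , moved , near = record
    { arrival  = level (x t j) + suc t
    ; arrives  = free-run (level (x t j)) (suc t) (cong level (proj₂ bl))
                   (≤-trans (proj₁ (proj₁ bl)) (n≤1+n t)) after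
    ; delayers = j ∷ delayers
    ; distinct = All.map (λ dom j≡i → <-irrefl (cong prio j≡i) (<-≤-trans higher dom)) dominate
                 ∷ distinct
    ; dominate = ≤-refl ∷ All.map (≤-trans (<⇒≤ higher)) dominate
    ; on-time  = begin
        level (x t j) + suc t                        ≤⟨ after-blocker bl moved near arrives ⟩
        arrival + weight j                           ≤⟨ +-monoˡ-≤ (weight j) on-time ⟩
        (T + sum (map weight delayers)) + weight j   ≡⟨ +-assoc T _ (weight j) ⟩
        T + (sum (map weight delayers) + weight j)   ≡⟨ cong (T +_) (+-comm _ (weight j)) ⟩
        T + (weight j + sum (map weight delayers))   ∎ }
    where
    open Bound (higher-bound higher)
    open ≤-Reasoning

  bound-step : ∀ j → (∀ {k} → prio j < prio k → Bound k) → Bound j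
  bound-step j higher-bound with eventually-unblocked higher-bound
  ... | b , unblocked with lastWitness (λ t → blocked? t j) b unblocked
  ...   | inj₁ (t , bl , after) = last-blocked-bound bl after higher-bound
  ...   | inj₂ never            = never-blocked-bound never

  every-bound : ∀ j → Bound j
  every-bound = WF.All.wfRec (larger-wellFounded prio) _ Bound bound-step

theorem4p3 : (I : Instance) (x : Positions I) → FIFORun I x →
    (y : Positions I) → Feasible I y → (T : ℕ) → CompletesBy I y T →
    (j : Fin (Instance.m I)) →
      ∃[ t ] x t j ≡ Instance.sink I × γ₀ I * t ≤ (γ₀ I + γ I) * T
theorem4p3 I x (prio , _ , _ , run) y feasible T done j = arrival , arrives , (begin
  γ₀ I * arrival                                         ≤⟨ *-monoʳ-≤ (γ₀ I) on-time ⟩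
  γ₀ I * (T + sum (map weight delayers))                 ≡⟨ *-distribˡ-+ (γ₀ I) T _ ⟩
  γ₀ I * T + γ₀ I * sum (map weight delayers)            ≤⟨ +-monoʳ-≤ (γ₀ I * T) (sum-exchange γ₀≤γ (level ∘ origin) delayers) ⟩
  γ₀ I * T + γ I * sum (map (λ k → level (origin k) ⊓ γ₀ I) delayers)
                                                         ≤⟨ +-monoʳ-≤ (γ₀ I * T) (*-monoʳ-≤ (γ I) (core-sum≤T delayers distinct)) ⟩
  γ₀ I * T + γ I * T                                     ≡⟨ sym (*-distribʳ-+ T (γ₀ I) (γ I)) ⟩
  (γ₀ I + γ I) * T                                       ∎)
  where
  open Instance I
  open Levels I
  open LowerBounds I y feasible T done using (core-sum≤T; solo-bound)
  open GreedyBound I prio x run T solo-bound using (weight; every-bound; module Bound)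
  open Bound (every-bound j)
  open ≤-Reasoning
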